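{- Let $k\ge0$ and let $\varphi$ be a formula of the language of $\mathsf{HA}$. If $\mathsf{HA}+\mathrm{LEM}(\Sigma_k)\vdash\varphi$, then $\mathsf{HA}^{*}+\mathrm{LEM}(\Sigma_k)\vdash\varphi^{*}$.
   Context: $\mathsf{HA}$ is intuitionistic first-order arithmetic with function symbols for all primitive recursive functions and logical constants $\forall,\exists,\to,\land,\lor,\perp$ ($\neg\varphi:\equiv\varphi\to\perp$). $\Sigma_0=\Pi_0$ = quantifier-free formulas; $\Sigma_{m+1}$ = formulas $\exists x_1\cdots\exists x_n\varphi$, $\varphi\in\Pi_m$; $\Pi_{m+1}$ = formulas $\forall x_1\cdots\forall x_n\varphi$, $\varphi\in\Sigma_m$. $\mathrm{LEM}(\Sigma_k)$ is the scheme $\varphi\lor\neg\varphi$ for $\varphi\in\Sigma_k$ of the language of $\mathsf{HA}$ (free variables allowed). $\mathsf{HA}^{*}$ is $\mathsf{HA}$ in the language extended by a $0$-ary predicate symbol $*$ (all schemes, including induction, range over the extended language); in $\mathsf{HA}^{*}+\mathrm{LEM}(\Sigma_k)$ the scheme $\mathrm{LEM}(\Sigma_k)$ is only for formulas of the original language. The Friedman A-translation $\varphi^{*}$ of an $\mathsf{HA}$-formula $\varphi$ is obtained by replacing every prime formula $P$ (including $\perp$) occurring in $\varphi$ by $P\lor *$; officially: $P^*:\equiv P\lor *$ for prime $P$, and $(\cdot)^*$ commutes with $\land,\lor,\to,\forall x,\exists x$. -}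

module Defs where

open import Data.Nat using (ℕ; zero; suc)
open import Data.Fin using (Fin)
open import Data.Vec using (Vec; []; _∷_; lookup)
open import Data.List using (List; map)
open import Data.List.Membership.Propositional using (_∈_)
open import Data.Empty using (⊥; ⊥-elim)
open import Data.Unit using (⊤; tt)
open import Data.Product using (Σ; _×_)
open import Data.Sum using (_⊎_)
open import Relation.Binary.PropositionalEquality using (_≡_)

data PR : ℕ → Set where
  Z    : PR 0
  S    : PR 1
  proj : ∀ {n} → Fin n → PR n
  comp : ∀ {m n} → PR m → Vec (PR n) m → PR n
  rec  : ∀ {n} → PR n → PR (suc (suc n)) → PR (suc n)

-- Terms (de Bruijn variables)

data Term : Set where
  var : ℕ → Term
  app : ∀ {n} → PR n → Vec Term n → Term

𝟎 : Term
𝟎 = app Z []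

𝐒 : Term → Term
𝐒 t = app S (t ∷ [])

mutual
  substT : (ℕ → Term) → Term → Term
  substT σ (var x)    = σ x
  substT σ (app f ts) = app f (substTs σ ts)

  substTs : ∀ {n} → (ℕ → Term) → Vec Term n → Vec Term n
  substTs σ []       = []
  substTs σ (t ∷ ts) = substT σ t ∷ substTs σ ts

shiftT : Term → Term
shiftT = substT (λ x → var (suc x))

lift : (ℕ → Term) → ℕ → Term
lift σ zero    = var zero
lift σ (suc x) = shiftT (σ x)

sub0 : Term → ℕ → Term
sub0 t zero    = t
sub0 t (suc x) = var x

-- Formulas over a set A of extra 0-ary predicate symbols.
-- Language of HA: Fm ⊥.  Language of HA*: Fm ⊤ (tt is the symbol *).

infixr 6 _∧'_
infixr 5 _∨'_
infixr 4 _⇒_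
infix  7 _≐_

data Fm (A : Set) : Set where
  _≐_   : Term → Term → Fm A
  ⊥'    : Fm A
  atom  : A → Fm A
  _∧'_  : Fm A → Fm A → Fm A
  _∨'_  : Fm A → Fm A → Fm A
  _⇒_   : Fm A → Fm A → Fm A
  ∀'    : Fm A → Fm A                 -- binds variable 0
  ∃'    : Fm A → Fm A

¬' : ∀ {A} → Fm A → Fm A
¬' φ = φ ⇒ ⊥'

substF : ∀ {A} → (ℕ → Term) → Fm A → Fm A
substF σ (t ≐ s)  = substT σ t ≐ substT σ s
substF σ ⊥'       = ⊥'
substF σ (atom a) = atom a
substF σ (φ ∧' ψ) = substF σ φ ∧' substF σ ψ
substF σ (φ ∨' ψ) = substF σ φ ∨' substF σ ψ
substF σ (φ ⇒ ψ)  = substF σ φ ⇒ substF σ ψ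
substF σ (∀' φ)   = ∀' (substF (lift σ) φ)
substF σ (∃' φ)   = ∃' (substF (lift σ) φ)

shiftF : ∀ {A} → Fm A → Fm A
shiftF = substF (λ x → var (suc x))

_[_] : ∀ {A} → Fm A → Term → Fm A
φ [ t ] = substF (sub0 t) φ

data QF : Fm ⊥ → Set where
  qf-eq  : ∀ t s → QF (t ≐ s)
  qf-bot : QF ⊥'
  qf-∧   : ∀ {φ ψ} → QF φ → QF ψ → QF (φ ∧' ψ)
  qf-∨   : ∀ {φ ψ} → QF φ → QF ψ → QF (φ ∨' ψ)
  qf-⇒   : ∀ {φ ψ} → QF φ → QF ψ → QF (φ ⇒ ψ)

mutual
  data Sig : ℕ → Fm ⊥ → Set where
    sig0   : ∀ {φ} → QF φ → Sig zero φ
    sig-in : ∀ {m φ} → Pi m φ → Sig (suc m) φ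
    sig-∃  : ∀ {m φ} → Sig (suc m) φ → Sig (suc m) (∃' φ)

  data Pi : ℕ → Fm ⊥ → Set where
    pi0   : ∀ {φ} → QF φ → Pi zero φ
    pi-in : ∀ {m φ} → Sig m φ → Pi (suc m) φ
    pi-∀  : ∀ {m φ} → Pi (suc m) φ → Pi (suc m) (∀' φ)

infix 2 _⨾_⊢_

data _⨾_⊢_ {A : Set} (Ax : Fm A → Set) : List (Fm A) → Fm A → Set where
  hyp  : ∀ {Γ φ} → φ ∈ Γ → Ax ⨾ Γ ⊢ φ
  ax   : ∀ {Γ φ} → Ax φ → Ax ⨾ Γ ⊢ φ
  ∧I   : ∀ {Γ φ ψ} → Ax ⨾ Γ ⊢ φ → Ax ⨾ Γ ⊢ ψ → Ax ⨾ Γ ⊢ φ ∧' ψ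
  ∧E₁  : ∀ {Γ φ ψ} → Ax ⨾ Γ ⊢ φ ∧' ψ → Ax ⨾ Γ ⊢ φ
  ∧E₂  : ∀ {Γ φ ψ} → Ax ⨾ Γ ⊢ φ ∧' ψ → Ax ⨾ Γ ⊢ ψ
  ∨I₁  : ∀ {Γ φ ψ} → Ax ⨾ Γ ⊢ φ → Ax ⨾ Γ ⊢ φ ∨' ψ
  ∨I₂  : ∀ {Γ φ ψ} → Ax ⨾ Γ ⊢ ψ → Ax ⨾ Γ ⊢ φ ∨' ψ
  ∨E   : ∀ {Γ φ ψ χ} → Ax ⨾ Γ ⊢ φ ∨' ψ →
         Ax ⨾ (φ Data.List.∷ Γ) ⊢ χ → Ax ⨾ (ψ Data.List.∷ Γ) ⊢ χ → Ax ⨾ Γ ⊢ χ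
  ⇒I   : ∀ {Γ φ ψ} → Ax ⨾ (φ Data.List.∷ Γ) ⊢ ψ → Ax ⨾ Γ ⊢ φ ⇒ ψ
  ⇒E   : ∀ {Γ φ ψ} → Ax ⨾ Γ ⊢ φ ⇒ ψ → Ax ⨾ Γ ⊢ φ → Ax ⨾ Γ ⊢ ψ
  ⊥E   : ∀ {Γ φ} → Ax ⨾ Γ ⊢ ⊥' → Ax ⨾ Γ ⊢ φ
  ∀I   : ∀ {Γ φ} → Ax ⨾ map shiftF Γ ⊢ φ → Ax ⨾ Γ ⊢ ∀' φ
  ∀E   : ∀ {Γ φ} (t : Term) → Ax ⨾ Γ ⊢ ∀' φ → Ax ⨾ Γ ⊢ φ [ t ]
  ∃I   : ∀ {Γ φ} (t : Term) → Ax ⨾ Γ ⊢ φ [ t ] → Ax ⨾ Γ ⊢ ∃' φ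
  ∃E   : ∀ {Γ φ ψ} → Ax ⨾ Γ ⊢ ∃' φ →
         Ax ⨾ (φ Data.List.∷ map shiftF Γ) ⊢ shiftF ψ → Ax ⨾ Γ ⊢ ψ

stepF : ∀ {A} → Fm A → Fm A
stepF φ = substF (λ { zero → 𝐒 (var zero) ; (suc x) → var (suc x) }) φ

data HAax {A : Set} : Fm A → Set where
  eq-refl  : ∀ t → HAax (t ≐ t)
  eq-subst : ∀ t s (φ : Fm A) → HAax (t ≐ s ⇒ φ [ t ] ⇒ φ [ s ])
  S-not0   : ∀ t → HAax (¬' (𝐒 t ≐ 𝟎))
  S-inj    : ∀ t s → HAax (𝐒 t ≐ 𝐒 s ⇒ t ≐ s)
  def-proj : ∀ {n} (i : Fin n) (ts : Vec Term n) →
             HAax (app (proj i) ts ≐ lookup ts i)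
  def-comp : ∀ {m n} (f : PR m) (gs : Vec (PR n) m) (ts : Vec Term n) →
             HAax (app (comp f gs) ts ≐ app f (Data.Vec.map (λ g → app g ts) gs))
  def-rec0 : ∀ {n} (f : PR n) (g : PR (suc (suc n))) (ts : Vec Term n) →
             HAax (app (rec f g) (𝟎 ∷ ts) ≐ app f ts)
  def-recS : ∀ {n} (f : PR n) (g : PR (suc (suc n))) (t : Term) (ts : Vec Term n) →
             HAax (app (rec f g) (𝐒 t ∷ ts) ≐ app g (t ∷ app (rec f g) (t ∷ ts) ∷ ts))
  ind      : ∀ (φ : Fm A) → HAax (φ [ 𝟎 ] ⇒ ∀' (φ ⇒ stepF φ) ⇒ ∀' φ)

emb : Fm ⊥ → Fm ⊤
emb (t ≐ s)  = t ≐ s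
emb ⊥'       = ⊥'
emb (atom ())
emb (φ ∧' ψ) = emb φ ∧' emb ψ
emb (φ ∨' ψ) = emb φ ∨' emb ψ
emb (φ ⇒ ψ)  = emb φ ⇒ emb ψ
emb (∀' φ)   = ∀' (emb φ)
emb (∃' φ)   = ∃' (emb φ)

* : Fm ⊤
* = atom tt

_ᴬ : Fm ⊥ → Fm ⊤
(t ≐ s) ᴬ  = (t ≐ s) ∨' *
⊥' ᴬ       = ⊥' ∨' *
(atom ()) ᴬ
(φ ∧' ψ) ᴬ = φ ᴬ ∧' ψ ᴬ
(φ ∨' ψ) ᴬ = φ ᴬ ∨' ψ ᴬ
(φ ⇒ ψ) ᴬ  = φ ᴬ ⇒ ψ ᴬ
(∀' φ) ᴬ   = ∀' (φ ᴬ)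
(∃' φ) ᴬ   = ∃' (φ ᴬ)

data LEM : ℕ → Fm ⊥ → Set where
  lem : ∀ {k} (ψ : Fm ⊥) → Sig k ψ → LEM k (ψ ∨' ¬' ψ)

data LEM* : ℕ → Fm ⊤ → Set where
  lem* : ∀ {k} (ψ : Fm ⊥) → Sig k ψ → LEM* k (emb (ψ ∨' ¬' ψ))

HA+LEM : ℕ → Fm ⊥ → Set
HA+LEM k φ = HAax φ ⊎ LEM k φ

HA*+LEM : ℕ → Fm ⊤ → Set
HA*+LEM k φ = HAax φ ⊎ LEM* k φ

-- Since every prime
-- formula P becomes P ∨ *, the formula * proves every φᴬ, which handles ⊥E; the
-- HA axioms translate to instances of themselves, because substitution commutes
-- with ᴬ and induction is available for the whole extended language. The one real
-- step is LEM(Σₖ): for ψ ∈ Σₖ, LEM(Σₖ) in HA* yields ψ ∨ ψᵈ, where ψᵈ ∈ Πₖ is the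
-- classical negation of ψ pushed through its quantifier prefix. Decidability of
-- quantifier-free formulas then gives ψ → ψᴬ and ψᵈ → ψᴬ → *, hence ψᴬ ∨ (¬ψ)ᴬ.
module Submission where

open import Defs
open import Data.Nat using (ℕ; zero; suc; _≤_; z≤n; s≤s)
open import Data.Nat.Properties using (<⇒≤; ≤-refl)
open import Data.Empty using (⊥)
open import Data.Unit using (⊤)
open import Data.Sum using (inj₁; inj₂)
open import Data.List using (List; []; _∷_; map)
open import Data.List.Relation.Unary.Any using (here; there)
open import Data.List.Membership.Propositional.Properties using (∈-map⁺)
open import Data.Vec as Vec using (Vec)
open import Relation.Binary.PropositionalEquality
  using (_≡_; refl; sym; trans; cong; cong₂; module ≡-Reasoning)

shift : ℕ → Term
shift x = var (suc x)

mutual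
  substT-fusion : ∀ {σ τ ρ} → (∀ x → substT σ (τ x) ≡ ρ x) →
                  ∀ t → substT σ (substT τ t) ≡ substT ρ t
  substT-fusion eq (var x)    = eq x
  substT-fusion eq (app f ts) = cong (app f) (substTs-fusion eq ts)

  substTs-fusion : ∀ {σ τ ρ n} → (∀ x → substT σ (τ x) ≡ ρ x) →
                   (ts : Vec Term n) → substTs σ (substTs τ ts) ≡ substTs ρ ts
  substTs-fusion eq Vec.[]       = refl
  substTs-fusion eq (t Vec.∷ ts) = cong₂ Vec._∷_ (substT-fusion eq t) (substTs-fusion eq ts)

lift-fusion : ∀ {σ τ ρ} → (∀ x → substT σ (τ x) ≡ ρ x) →
              ∀ x → substT (lift σ) (lift τ x) ≡ lift ρ x
lift-fusion eq zero = refl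
lift-fusion {σ} {τ} {ρ} eq (suc x) = begin
  substT (lift σ) (shiftT (τ x))          ≡⟨ substT-fusion {τ = shift} (λ _ → refl) (τ x) ⟩
  substT (λ y → shiftT (σ y)) (τ x)       ≡⟨ substT-fusion {σ = shift} (λ _ → refl) (τ x) ⟨
  shiftT (substT σ (τ x))                 ≡⟨ cong shiftT (eq x) ⟩
  shiftT (ρ x)                            ∎
  where open ≡-Reasoning

substF-fusion : ∀ {A σ τ ρ} → (∀ x → substT σ (τ x) ≡ ρ x) →
                (φ : Fm A) → substF σ (substF τ φ) ≡ substF ρ φ
substF-fusion eq (t ≐ s)  = cong₂ _≐_ (substT-fusion eq t) (substT-fusion eq s)
substF-fusion eq ⊥'       = refl
substF-fusion eq (atom a) = refl
substF-fusion eq (φ ∧' ψ) = cong₂ _∧'_ (substF-fusion eq φ) (substF-fusion eq ψ)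
substF-fusion eq (φ ∨' ψ) = cong₂ _∨'_ (substF-fusion eq φ) (substF-fusion eq ψ)
substF-fusion eq (φ ⇒ ψ)  = cong₂ _⇒_ (substF-fusion eq φ) (substF-fusion eq ψ)
substF-fusion eq (∀' φ)   = cong ∀' (substF-fusion (lift-fusion eq) φ)
substF-fusion eq (∃' φ)   = cong ∃' (substF-fusion (lift-fusion eq) φ)

mutual
  substT-id : ∀ {σ} → (∀ x → σ x ≡ var x) → ∀ t → substT σ t ≡ t
  substT-id eq (var x)    = eq x
  substT-id eq (app f ts) = cong (app f) (substTs-id eq ts)

  substTs-id : ∀ {σ n} → (∀ x → σ x ≡ var x) → (ts : Vec Term n) → substTs σ ts ≡ ts
  substTs-id eq Vec.[]       = refl
  substTs-id eq (t Vec.∷ ts) = cong₂ Vec._∷_ (substT-id eq t) (substTs-id eq ts)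

lift-id : ∀ {σ} → (∀ x → σ x ≡ var x) → ∀ x → lift σ x ≡ var x
lift-id eq zero    = refl
lift-id eq (suc x) = cong shiftT (eq x)

substF-id : ∀ {A σ} → (∀ x → σ x ≡ var x) → (φ : Fm A) → substF σ φ ≡ φ
substF-id eq (t ≐ s)  = cong₂ _≐_ (substT-id eq t) (substT-id eq s)
substF-id eq ⊥'       = refl
substF-id eq (atom a) = refl
substF-id eq (φ ∧' ψ) = cong₂ _∧'_ (substF-id eq φ) (substF-id eq ψ)
substF-id eq (φ ∨' ψ) = cong₂ _∨'_ (substF-id eq φ) (substF-id eq ψ)
substF-id eq (φ ⇒ ψ)  = cong₂ _⇒_ (substF-id eq φ) (substF-id eq ψ)
substF-id eq (∀' φ)   = cong ∀' (substF-id (lift-id eq) φ)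
substF-id eq (∃' φ)   = cong ∃' (substF-id (lift-id eq) φ)

substF-var : ∀ {A} (φ : Fm A) → substF var φ ≡ φ
substF-var = substF-id (λ _ → refl)

lift-shift-[var0] : ∀ {A} (φ : Fm A) → substF (lift shift) φ [ var 0 ] ≡ φ
lift-shift-[var0] φ = trans (substF-fusion {ρ = var} cancel φ) (substF-var φ)
  where
  cancel : ∀ x → substT (sub0 (var 0)) (lift shift x) ≡ var x
  cancel zero    = refl
  cancel (suc x) = refl

ᴬ-substF : ∀ σ (φ : Fm ⊥) → substF σ φ ᴬ ≡ substF σ (φ ᴬ)
ᴬ-substF σ (t ≐ s)  = refl
ᴬ-substF σ ⊥'       = refl
ᴬ-substF σ (atom ())
ᴬ-substF σ (φ ∧' ψ) = cong₂ _∧'_ (ᴬ-substF σ φ) (ᴬ-substF σ ψ)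
ᴬ-substF σ (φ ∨' ψ) = cong₂ _∨'_ (ᴬ-substF σ φ) (ᴬ-substF σ ψ)
ᴬ-substF σ (φ ⇒ ψ)  = cong₂ _⇒_ (ᴬ-substF σ φ) (ᴬ-substF σ ψ)
ᴬ-substF σ (∀' φ)   = cong ∀' (ᴬ-substF (lift σ) φ)
ᴬ-substF σ (∃' φ)   = cong ∃' (ᴬ-substF (lift σ) φ)

map-ᴬ-shiftF : (Γ : List (Fm ⊥)) → map _ᴬ (map shiftF Γ) ≡ map shiftF (map _ᴬ Γ)
map-ᴬ-shiftF []      = refl
map-ᴬ-shiftF (γ ∷ Γ) = cong₂ _∷_ (ᴬ-substF shift γ) (map-ᴬ-shiftF Γ)

mutual
  QF⇒Sig : ∀ m {φ} → QF φ → Sig m φ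
  QF⇒Sig zero    q = sig0 q
  QF⇒Sig (suc m) q = sig-in (QF⇒Pi m q)

  QF⇒Pi : ∀ m {φ} → QF φ → Pi m φ
  QF⇒Pi zero    q = pi0 q
  QF⇒Pi (suc m) q = pi-in (QF⇒Sig m q)

mutual
  Sig-mono : ∀ {m n φ} → m ≤ n → Sig m φ → Sig n φ
  Sig-mono {n = n} z≤n  (sig0 q)   = QF⇒Sig n q
  Sig-mono (s≤s m≤n)    (sig-in p) = sig-in (Pi-mono m≤n p)
  Sig-mono m≤n@(s≤s _)  (sig-∃ s)  = sig-∃ (Sig-mono m≤n s)

  Pi-mono : ∀ {m n φ} → m ≤ n → Pi m φ → Pi n φ
  Pi-mono {n = n} z≤n  (pi0 q)   = QF⇒Pi n q
  Pi-mono (s≤s m≤n)    (pi-in s) = pi-in (Sig-mono m≤n s)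
  Pi-mono m≤n@(s≤s _)  (pi-∀ p)  = pi-∀ (Pi-mono m≤n p)

-- Classical negation pushed through the quantifier prefix down to the matrix.
mutual
  dualΣ : ∀ {m φ} → Sig m φ → Fm ⊥
  dualΣ (sig0 {φ} q) = ¬' φ
  dualΣ (sig-in p)   = dualΠ p
  dualΣ (sig-∃ s)    = ∀' (dualΣ s)

  dualΠ : ∀ {m φ} → Pi m φ → Fm ⊥
  dualΠ (pi0 {φ} q) = ¬' φ
  dualΠ (pi-in s)   = dualΣ s
  dualΠ (pi-∀ p)    = ∃' (dualΠ p)

mutual
  dualΣ-Pi : ∀ {m φ} (s : Sig m φ) → Pi m (dualΣ s)
  dualΣ-Pi (sig0 q)   = pi0 (qf-⇒ q qf-bot)
  dualΣ-Pi (sig-in p) = pi-in (dualΠ-Sig p)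
  dualΣ-Pi (sig-∃ s)  = pi-∀ (dualΣ-Pi s)

  dualΠ-Sig : ∀ {m φ} (p : Pi m φ) → Sig m (dualΠ p)
  dualΠ-Sig (pi0 q)   = sig0 (qf-⇒ q qf-bot)
  dualΠ-Sig (pi-in s) = sig-in (dualΣ-Pi s)
  dualΠ-Sig (pi-∀ p)  = sig-∃ (dualΠ-Sig p)

module _ {A : Set} {Ax : Fm A → Set} where

  ⊢-cast : ∀ {Γ φ ψ} → φ ≡ ψ → Ax ⨾ Γ ⊢ φ → Ax ⨾ Γ ⊢ ψ
  ⊢-cast refl d = d

  ⊢-castΓ : ∀ {Γ Δ φ} → Γ ≡ Δ → Ax ⨾ Γ ⊢ φ → Ax ⨾ Δ ⊢ φ
  ⊢-castΓ refl d = d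

  hyp₀ : ∀ {Γ φ} → Ax ⨾ φ ∷ Γ ⊢ φ
  hyp₀ = hyp (here refl)

  hyp₁ : ∀ {Γ φ ψ} → Ax ⨾ ψ ∷ φ ∷ Γ ⊢ φ
  hyp₁ = hyp (there (here refl))

  hyp₂ : ∀ {Γ φ ψ χ} → Ax ⨾ χ ∷ ψ ∷ φ ∷ Γ ⊢ φ
  hyp₂ = hyp (there (there (here refl)))

  ∀E-shifted : ∀ {Γ φ} → Ax ⨾ Γ ⊢ shiftF (∀' φ) → Ax ⨾ Γ ⊢ φ
  ∀E-shifted {φ = φ} d = ⊢-cast (lift-shift-[var0] φ) (∀E (var 0) d)

  ∃I-shifted : ∀ {Γ φ} → Ax ⨾ Γ ⊢ φ → Ax ⨾ Γ ⊢ shiftF (∃' φ)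
  ∃I-shifted {φ = φ} d = ∃I (var 0) (⊢-cast (sym (lift-shift-[var0] φ)) d)

-- Generalised over substitutions: the ∃ case needs an instance of the body.
*⇒substFᴬ : ∀ {Ax Γ} σ (φ : Fm ⊥) → Ax ⨾ Γ ⊢ * ⇒ substF σ (φ ᴬ)
*⇒substFᴬ σ (t ≐ s)  = ⇒I (∨I₂ hyp₀)
*⇒substFᴬ σ ⊥'       = ⇒I (∨I₂ hyp₀)
*⇒substFᴬ σ (atom ())
*⇒substFᴬ σ (φ ∧' ψ) = ⇒I (∧I (⇒E (*⇒substFᴬ σ φ) hyp₀) (⇒E (*⇒substFᴬ σ ψ) hyp₀))
*⇒substFᴬ σ (φ ∨' ψ) = ⇒I (∨I₁ (⇒E (*⇒substFᴬ σ φ) hyp₀))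
*⇒substFᴬ σ (φ ⇒ ψ)  = ⇒I (⇒I (⇒E (*⇒substFᴬ σ ψ) hyp₁))
*⇒substFᴬ σ (∀' φ)   = ⇒I (∀I (⇒E (*⇒substFᴬ (lift σ) φ) hyp₀))
*⇒substFᴬ σ (∃' φ)   = ⇒I (∃I 𝟎
  (⊢-cast (sym (substF-fusion (λ _ → refl) (φ ᴬ)))
          (⇒E (*⇒substFᴬ (λ x → substT (sub0 𝟎) (lift σ x)) φ) hyp₀)))

*⇒ᴬ : ∀ {Ax Γ} (φ : Fm ⊥) → Ax ⨾ Γ ⊢ * ⇒ φ ᴬ
*⇒ᴬ φ = ⊢-cast (cong (* ⇒_) (substF-var (φ ᴬ))) (*⇒substFᴬ var φ)

module _ (k : ℕ) where

  private
    T : Fm ⊤ → Set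
    T = HA*+LEM k

  LEM-QF : ∀ {Γ φ} → QF φ → T ⨾ Γ ⊢ emb (φ ∨' ¬' φ)
  LEM-QF {φ = φ} q = ax (inj₂ (lem* φ (QF⇒Sig k q)))

  mutual
    emb⇒ᴬ-QF : ∀ {Γ φ} → QF φ → T ⨾ Γ ⊢ emb φ ⇒ φ ᴬ
    emb⇒ᴬ-QF (qf-eq t s) = ⇒I (∨I₁ hyp₀)
    emb⇒ᴬ-QF qf-bot      = ⇒I (⊥E hyp₀)
    emb⇒ᴬ-QF (qf-∧ p q)  =
      ⇒I (∧I (⇒E (emb⇒ᴬ-QF p) (∧E₁ hyp₀)) (⇒E (emb⇒ᴬ-QF q) (∧E₂ hyp₀)))
    emb⇒ᴬ-QF (qf-∨ p q)  =
      ⇒I (∨E hyp₀ (∨I₁ (⇒E (emb⇒ᴬ-QF p) hyp₀)) (∨I₂ (⇒E (emb⇒ᴬ-QF q) hyp₀)))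
    emb⇒ᴬ-QF (qf-⇒ {ψ = ψ} p q) =
      ⇒I (⇒I (∨E (⇒E (ᴬ⇒emb∨*-QF p) hyp₀)
                 (⇒E (emb⇒ᴬ-QF q) (⇒E hyp₂ hyp₀))
                 (⇒E (*⇒ᴬ ψ) hyp₀)))

    ᴬ⇒emb∨*-QF : ∀ {Γ φ} → QF φ → T ⨾ Γ ⊢ φ ᴬ ⇒ emb φ ∨' *
    ᴬ⇒emb∨*-QF (qf-eq t s) = ⇒I hyp₀
    ᴬ⇒emb∨*-QF qf-bot      = ⇒I hyp₀
    ᴬ⇒emb∨*-QF (qf-∧ p q)  =
      ⇒I (∨E (⇒E (ᴬ⇒emb∨*-QF p) (∧E₁ hyp₀))
             (∨E (⇒E (ᴬ⇒emb∨*-QF q) (∧E₂ hyp₁)) (∨I₁ (∧I hyp₁ hyp₀)) (∨I₂ hyp₀))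
             (∨I₂ hyp₀))
    ᴬ⇒emb∨*-QF (qf-∨ p q)  =
      ⇒I (∨E hyp₀ (∨E (⇒E (ᴬ⇒emb∨*-QF p) hyp₀) (∨I₁ (∨I₁ hyp₀)) (∨I₂ hyp₀))
                  (∨E (⇒E (ᴬ⇒emb∨*-QF q) hyp₀) (∨I₁ (∨I₂ hyp₀)) (∨I₂ hyp₀)))
    ᴬ⇒emb∨*-QF (qf-⇒ p q)  =
      ⇒I (∨E (LEM-QF p)
             (∨E (⇒E (ᴬ⇒emb∨*-QF q) (⇒E hyp₁ (⇒E (emb⇒ᴬ-QF p) hyp₀)))
                 (∨I₁ (⇒I hyp₁))
                 (∨I₂ hyp₀))
             (∨I₁ (⇒I (⊥E (⇒E hyp₁ hyp₀)))))

  mutual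
    emb⇒ᴬ-Sig : ∀ {Γ m φ} → Sig m φ → T ⨾ Γ ⊢ emb φ ⇒ φ ᴬ
    emb⇒ᴬ-Sig (sig0 q)   = emb⇒ᴬ-QF q
    emb⇒ᴬ-Sig (sig-in p) = emb⇒ᴬ-Pi p
    emb⇒ᴬ-Sig (sig-∃ s)  = ⇒I (∃E hyp₀ (∃I-shifted (⇒E (emb⇒ᴬ-Sig s) hyp₀)))

    emb⇒ᴬ-Pi : ∀ {Γ m φ} → Pi m φ → T ⨾ Γ ⊢ emb φ ⇒ φ ᴬ
    emb⇒ᴬ-Pi (pi0 q)   = emb⇒ᴬ-QF q
    emb⇒ᴬ-Pi (pi-in s) = emb⇒ᴬ-Sig s
    emb⇒ᴬ-Pi (pi-∀ p)  = ⇒I (∀I (⇒E (emb⇒ᴬ-Pi p) (∀E-shifted hyp₀)))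

  ¬emb⇒ᴬ⇒*-QF : ∀ {Γ φ} → QF φ → T ⨾ Γ ⊢ emb (¬' φ) ⇒ φ ᴬ ⇒ *
  ¬emb⇒ᴬ⇒*-QF q = ⇒I (⇒I (∨E (⇒E (ᴬ⇒emb∨*-QF q) hyp₀) (⊥E (⇒E hyp₂ hyp₀)) hyp₀))

  mutual
    dualΣ⇒ᴬ⇒* : ∀ {Γ m φ} (s : Sig m φ) → T ⨾ Γ ⊢ emb (dualΣ s) ⇒ φ ᴬ ⇒ *
    dualΣ⇒ᴬ⇒* (sig0 q)   = ¬emb⇒ᴬ⇒*-QF q
    dualΣ⇒ᴬ⇒* (sig-in p) = dualΠ⇒ᴬ⇒* p
    dualΣ⇒ᴬ⇒* (sig-∃ s)  =
      ⇒I (⇒I (∃E hyp₀ (⇒E (⇒E (dualΣ⇒ᴬ⇒* s) (∀E-shifted hyp₂)) hyp₀)))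

    dualΠ⇒ᴬ⇒* : ∀ {Γ m φ} (p : Pi m φ) → T ⨾ Γ ⊢ emb (dualΠ p) ⇒ φ ᴬ ⇒ *
    dualΠ⇒ᴬ⇒* (pi0 q)   = ¬emb⇒ᴬ⇒*-QF q
    dualΠ⇒ᴬ⇒* (pi-in s) = dualΣ⇒ᴬ⇒* s
    dualΠ⇒ᴬ⇒* (pi-∀ p)  =
      ⇒I (⇒I (∃E hyp₁ (⇒E (⇒E (dualΠ⇒ᴬ⇒* p) hyp₀) (∀E-shifted hyp₁))))

  -- Each quantifier of the prefix costs one use of LEM for a Σ-formula of level ≤ k.
  mutual
    emb∨dualΣ : ∀ {Γ m φ} → m ≤ k → (s : Sig m φ) → T ⨾ Γ ⊢ emb φ ∨' emb (dualΣ s)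
    emb∨dualΣ m≤k (sig0 q)   = LEM-QF q
    emb∨dualΣ m<k (sig-in p) = emb∨dualΠ (<⇒≤ m<k) p
    emb∨dualΣ m≤k (sig-∃ {φ = φ} s) =
      ∨E (ax (inj₂ (lem* (∃' φ) (Sig-mono m≤k (sig-∃ s)))))
         (∨I₁ hyp₀)
         (∨I₂ (∀I (∨E (emb∨dualΣ m≤k s) (⊥E (⇒E hyp₁ (∃I-shifted hyp₀))) hyp₀)))

    emb∨dualΠ : ∀ {Γ m φ} → m ≤ k → (p : Pi m φ) → T ⨾ Γ ⊢ emb φ ∨' emb (dualΠ p)
    emb∨dualΠ m≤k (pi0 q)   = LEM-QF q
    emb∨dualΠ m<k (pi-in s) = emb∨dualΣ (<⇒≤ m<k) s
    emb∨dualΠ m≤k (pi-∀ p)  =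
      ∨E (ax (inj₂ (lem* (∃' (dualΠ p)) (Sig-mono m≤k (sig-∃ (dualΠ-Sig p))))))
         (∨I₂ hyp₀)
         (∨I₁ (∀I (∨E (emb∨dualΠ m≤k p) hyp₀ (⊥E (⇒E hyp₁ (∃I-shifted hyp₀))))))

  LEMᴬ : ∀ {Γ φ} → LEM k φ → T ⨾ Γ ⊢ φ ᴬ
  LEMᴬ (lem ψ s) =
    ∨E (emb∨dualΣ ≤-refl s)
       (∨I₁ (⇒E (emb⇒ᴬ-Sig s) hyp₀))
       (∨I₂ (⇒I (∨I₂ (⇒E (⇒E (dualΣ⇒ᴬ⇒* s) hyp₁) hyp₀))))

  HAaxᴬ : ∀ {Γ φ} → HAax φ → T ⨾ Γ ⊢ φ ᴬ
  HAaxᴬ (eq-refl t)          = ∨I₁ (ax (inj₁ (eq-refl t)))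
  HAaxᴬ (eq-subst t s φ)     =
    ⇒I (∨E hyp₀
      (⊢-cast (cong₂ _⇒_ (sym (ᴬ-substF (sub0 t) φ)) (sym (ᴬ-substF (sub0 s) φ)))
             (⇒E (ax (inj₁ (eq-subst t s (φ ᴬ)))) hyp₀))
      (⇒I (⇒E (*⇒ᴬ (φ [ s ])) hyp₁)))
  HAaxᴬ (S-not0 t)           = ⇒I (∨E hyp₀ (⊥E (⇒E (ax (inj₁ (S-not0 t))) hyp₀)) (∨I₂ hyp₀))
  HAaxᴬ (S-inj t s)          = ⇒I (∨E hyp₀ (∨I₁ (⇒E (ax (inj₁ (S-inj t s))) hyp₀)) (∨I₂ hyp₀))
  HAaxᴬ (def-proj i ts)      = ∨I₁ (ax (inj₁ (def-proj i ts)))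
  HAaxᴬ (def-comp f gs ts)   = ∨I₁ (ax (inj₁ (def-comp f gs ts)))
  HAaxᴬ (def-rec0 f g ts)    = ∨I₁ (ax (inj₁ (def-rec0 f g ts)))
  HAaxᴬ (def-recS f g t ts)  = ∨I₁ (ax (inj₁ (def-recS f g t ts)))
  HAaxᴬ (ind φ)              =
    ⊢-cast
      (cong₂ _⇒_ (sym (ᴬ-substF (sub0 𝟎) φ))
                 (cong (λ χ → ∀' (φ ᴬ ⇒ χ) ⇒ ∀' (φ ᴬ)) (sym (ᴬ-substF _ φ))))
      (ax (inj₁ (ind (φ ᴬ))))

  translate : ∀ {Γ φ} → HA+LEM k ⨾ Γ ⊢ φ → T ⨾ map _ᴬ Γ ⊢ φ ᴬ
  translate (hyp φ∈Γ)     = hyp (∈-map⁺ _ᴬ φ∈Γ)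
  translate (ax (inj₁ a)) = HAaxᴬ a
  translate (ax (inj₂ l)) = LEMᴬ l
  translate (∧I d e)      = ∧I (translate d) (translate e)
  translate (∧E₁ d)       = ∧E₁ (translate d)
  translate (∧E₂ d)       = ∧E₂ (translate d)
  translate (∨I₁ d)       = ∨I₁ (translate d)
  translate (∨I₂ d)       = ∨I₂ (translate d)
  translate (∨E d e f)    = ∨E (translate d) (translate e) (translate f)
  translate (⇒I d)        = ⇒I (translate d)
  translate (⇒E d e)      = ⇒E (translate d) (translate e)
  translate (⊥E {φ = φ} d) = ∨E (translate d) (⊥E hyp₀) (⇒E (*⇒ᴬ φ) hyp₀)
  translate (∀I {Γ} d)    = ∀I (⊢-castΓ (map-ᴬ-shiftF Γ) (translate d))
  translate (∀E {φ = φ} t d) = ⊢-cast (sym (ᴬ-substF (sub0 t) φ)) (∀E t (translate d))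
  translate (∃I {φ = φ} t d) = ∃I t (⊢-cast (ᴬ-substF (sub0 t) φ) (translate d))
  translate (∃E {Γ} {φ} {ψ} d e) =
    ∃E (translate d)
       (⊢-castΓ (cong (φ ᴬ ∷_) (map-ᴬ-shiftF Γ))
              (⊢-cast (ᴬ-substF shift ψ) (translate e)))

theorem8p3 : (k : ℕ) (φ : Fm ⊥) →
    HA+LEM k ⨾ [] ⊢ φ → HA*+LEM k ⨾ [] ⊢ φ ᴬ
theorem8p3 k φ = translate k
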